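{- For every graph $G$ and every integer $r\geq 4$, if $d := 2\lceil\log_{r-2} \pi(G)\rceil+1$ then $\pi(G^{(d)})\leq r+2$.
   Context: All graphs are finite, simple and undirected. A path in a graph is a sequence of pairwise distinct vertices, consecutive ones adjacent. Given a vertex colouring $\phi$, a sequence $(v_1,\dots,v_{2s})$ is repetitively coloured if $\phi(v_i)=\phi(v_{s+i})$ for all $i\in\{1,\dots,s\}$; a colouring is nonrepetitive if no path is repetitively coloured. $\pi(G)$ is the minimum number of colours in a nonrepetitive colouring of $G$. For an integer $d\ge 0$, $G^{(d)}$ denotes the $d$-subdivision of $G$: each edge $vw$ is replaced by a path from $v$ to $w$ with exactly $d$ internal vertices, these paths being internally disjoint. -}

module Defs where

open import Data.Nat using (ℕ; zero; suc; _+_; _*_; _^_; _≤_)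
open import Data.Fin using (Fin; toℕ)
open import Data.List using (List; _++_; map; length; lookup)
open import Data.List.Membership.Propositional using (_∈_)
open import Data.List.Relation.Unary.All using (All)
open import Data.List.Relation.Unary.AllPairs using (AllPairs)
open import Data.List.Relation.Unary.Unique.Propositional using (Unique)
open import Data.List.Relation.Unary.Linked using (Linked)
open import Data.Product using (Σ; _×_; _,_; proj₁; proj₂)
open import Data.Sum using (_⊎_; inj₁; inj₂)
open import Data.Empty using (⊥)
open import Relation.Nullary using (¬_)
open import Relation.Binary.PropositionalEquality using (_≡_; _≢_)

IsPath : {V : Set} → (V → V → Set) → List V → Set
IsPath Adj p = Unique p × Linked Adj p

-- φ is a nonrepetitive colouring with colours Fin c: no path
-- (v₁ … v_{2s}) = xs ++ ys, s = length xs ≥ 1, with φ(xs) = φ(ys)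
-- (equality of colour lists forces length ys = s).
Nonrepetitive : {V : Set} → (V → V → Set) → (c : ℕ) → (V → Fin c) → Set
Nonrepetitive Adj c φ =
  (xs ys : List _) → 1 ≤ length xs → IsPath Adj (xs ++ ys) →
  map φ xs ≡ map φ ys → ⊥

HasNonrepColouring : {V : Set} → (V → V → Set) → ℕ → Set
HasNonrepColouring {V} Adj c = Σ (V → Fin c) (Nonrepetitive Adj c)

IsPi : {V : Set} → (V → V → Set) → ℕ → Set
IsPi Adj k = HasNonrepColouring Adj k × (∀ c → HasNonrepColouring Adj c → k ≤ c)

IsCeilLog : ℕ → ℕ → ℕ → Set
IsCeilLog b k t = k ≤ b ^ t × (∀ s → k ≤ b ^ s → t ≤ s)

Edge : ℕ → Set
Edge n = Fin n × Fin n

SameEdge : {n : ℕ} → Edge n → Edge n → Set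
SameEdge (u , v) (u' , v') = (u ≡ u' × v ≡ v') ⊎ (u ≡ v' × v ≡ u')

Simple : (n : ℕ) → List (Edge n) → Set
Simple n E = All (λ e → proj₁ e ≢ proj₂ e) E × AllPairs (λ e f → ¬ SameEdge e f) E

Adj : {n : ℕ} → List (Edge n) → Fin n → Fin n → Set
Adj E u v = (u , v) ∈ E ⊎ (v , u) ∈ E

-- d-subdivision: original vertices inj₁ u, and for the k-th edge
-- its internal vertices inj₂ (k , 0) … inj₂ (k , d-1), in order from
-- the first to the second endpoint.

SubV : (n : ℕ) → List (Edge n) → ℕ → Set
SubV n E d = Fin n ⊎ (Fin (length E) × Fin d)

data SubArc {n : ℕ} (E : List (Edge n)) (d : ℕ) : SubV n E d → SubV n E d → Set where
  direct : (k : Fin (length E)) → d ≡ 0 →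
           SubArc E d (inj₁ (proj₁ (lookup E k))) (inj₁ (proj₂ (lookup E k)))
  first  : (k : Fin (length E)) (i : Fin d) → toℕ i ≡ 0 →
           SubArc E d (inj₁ (proj₁ (lookup E k))) (inj₂ (k , i))
  middle : (k : Fin (length E)) (i j : Fin d) → suc (toℕ i) ≡ toℕ j →
           SubArc E d (inj₂ (k , i)) (inj₂ (k , j))
  last   : (k : Fin (length E)) (i : Fin d) → suc (toℕ i) ≡ d →
           SubArc E d (inj₂ (k , i)) (inj₁ (proj₂ (lookup E k)))

SubAdj : {n : ℕ} → (E : List (Edge n)) → (d : ℕ) → SubV n E d → SubV n E d → Set
SubAdj E d x y = SubArc E d x y ⊎ SubArc E d y x

-- Assign to the colours of an optimal nonrepetitive colouring of G distinct square-free words of length t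
-- over r letters, which is possible because there are at least (r-2)^t ≥ π(G) of them, and let the codeword
-- of a vertex be the word of its colour. In the subdivision, the original vertices get one new colour and the
-- 2t+1 vertices on an edge uv get the codeword of u, a second new colour at the centre, and the codeword of v
-- backwards. A repetitively coloured path inside one subdivided edge would give a square in a codeword or
-- repeat the unique centre. Otherwise consecutive original vertices on the path are 2t+1 apart, so (after
-- reversing the path if necessary) each of them is followed by t vertices whose colours spell its codeword,
-- and the original vertices form a repetitively coloured path of G.

module Submission where

open import Defs
open import Data.Nat using (ℕ; zero; suc; z≤n; s≤s; z<s; _+_; _*_; _∸_; _^_; _≤_; _<_; _≤?_; _<?_)
open import Data.Nat.Properties
open import Data.Nat.Tactic.RingSolver using (solve-∀)
open import Data.Fin as Fin using (Fin; toℕ; inject≤)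
open import Data.Fin.Properties using (inject≤-injective; splitAt-join; toℕ-injective; toℕ<n)
open import Data.List
  using (List; []; _∷_; [_]; _++_; reverse; reverseAcc; map; length; lookup; take; drop; filter; allFin;
         cartesianProductWith; applyUpTo)
open import Data.List.Properties
  using (∷-injective; ∷-injectiveˡ; ∷-injectiveʳ; ≡-dec; ++-assoc; length-++; length-++-sucʳ; length-map;
         length-drop; length-tabulate; length-applyUpTo; length-reverse; map-∘; map-++; map-injective;
         map-applyUpTo; take-[]; take++drop≡id; reverse-++; unfold-reverse; reverse-map)
open import Data.List.Membership.Propositional using (_∈_)
open import Data.List.Membership.Propositional.Properties
  using (∈-++⁻; ∈-++⁺ˡ; ∈-++⁺ʳ; ∈-map⁺; ∈-∃++; ∈-filter⁺; ∈-filter⁻; ∈-lookup; ∈-allFin;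
         ∈-cartesianProductWith⁺; ∈-cartesianProductWith⁻)
open import Data.List.Relation.Unary.Any using (here; there)
open import Data.List.Relation.Unary.All as All using (All; []; _∷_)
open import Data.List.Relation.Unary.All.Properties as AllProps using ()
open import Data.List.Relation.Unary.AllPairs as AllPairs using ([]; _∷_)
open import Data.List.Relation.Unary.Linked as Linked using (Linked; []; [-]; _∷_)
open import Data.List.Relation.Unary.Unique.Propositional using (Unique)
import Data.List.Relation.Unary.Unique.Propositional.Properties as Unique
open import Data.List.Relation.Binary.Permutation.Propositional using (↭-sym)
open import Data.List.Relation.Binary.Permutation.Propositional.Properties using (All-resp-↭; ↭-reverse)
import Data.List.Relation.Binary.Permutation.Setoid as Perm
import Data.List.Relation.Binary.Permutation.Setoid.Properties as PermProps
open import Data.Product using (Σ; ∃; ∃₂; _×_; _,_; proj₁; proj₂; map₁)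
open import Data.Sum using (_⊎_; inj₁; inj₂)
open import Data.Empty using (⊥; ⊥-elim)
open import Data.Unit using (⊤; tt)
open import Function using (_∘_; Injective)
open import Relation.Nullary using (¬_; Dec; yes; no)
open import Relation.Nullary.Decidable using (_×-dec_; ¬?; map′)
open import Relation.Binary using (tri<; tri≈; tri>)
open import Relation.Binary.PropositionalEquality hiding ([_])

module _ {A : Set} where

  length-≤-⊆ : {xs ys : List A} → Unique xs → (∀ {x} → x ∈ xs → x ∈ ys) → length xs ≤ length ys
  length-≤-⊆ {[]} _ _ = z≤n
  length-≤-⊆ {x ∷ xs} {ys} (x∉xs ∷ xs!) xs⊆ys with ∈-∃++ (xs⊆ys (here refl))
  ... | h , k , refl = begin
    suc (length xs)      ≤⟨ s≤s (length-≤-⊆ xs! xs⊆h++k) ⟩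
    suc (length (h ++ k)) ≡⟨ length-++-sucʳ h x k ⟨
    length (h ++ x ∷ k)   ∎
    where
    open ≤-Reasoning
    xs⊆h++k : ∀ {z} → z ∈ xs → z ∈ h ++ k
    xs⊆h++k z∈xs with ∈-++⁻ h (xs⊆ys (there z∈xs))
    ... | inj₁ z∈h = ∈-++⁺ˡ z∈h
    ... | inj₂ (here refl) = ⊥-elim (All.lookup x∉xs z∈xs refl)
    ... | inj₂ (there z∈k) = ∈-++⁺ʳ h z∈k

  length-filter-split : ∀ {P : A → Set} (P? : ∀ x → Dec (P x)) xs →
                        length (filter P? xs) + length (filter (¬? ∘ P?) xs) ≡ length xs
  length-filter-split P? [] = refl
  length-filter-split P? (x ∷ xs) with P? x
  ... | yes _ = cong suc (length-filter-split P? xs)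
  ... | no _ = trans (+-suc _ _) (cong suc (length-filter-split P? xs))

  lookup-injective : {xs : List A} → Unique xs → ∀ {i j} → lookup xs i ≡ lookup xs j → i ≡ j
  lookup-injective {_ ∷ _} _ {Fin.zero} {Fin.zero} _ = refl
  lookup-injective (x∉xs ∷ _) {Fin.zero} {Fin.suc j} eq = ⊥-elim (All.lookup x∉xs (∈-lookup j) eq)
  lookup-injective (x∉xs ∷ _) {Fin.suc i} {Fin.zero} eq = ⊥-elim (All.lookup x∉xs (∈-lookup i) (sym eq))
  lookup-injective (_ ∷ xs!) {Fin.suc i} {Fin.suc j} eq = cong Fin.suc (lookup-injective xs! eq)

  nth : A → List A → ℕ → A
  nth d [] _ = d
  nth d (x ∷ xs) zero = x
  nth d (x ∷ xs) (suc i) = nth d xs i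

  nth-drop : ∀ d j xs i → nth d (drop j xs) i ≡ nth d xs (j + i)
  nth-drop d zero xs i = refl
  nth-drop d (suc j) [] i = refl
  nth-drop d (suc j) (x ∷ xs) i = nth-drop d j xs i

  take-≡-pointwise : ∀ d s (xs ys : List A) → s ≤ length xs → s ≤ length ys →
                     (∀ i → i < s → nth d xs i ≡ nth d ys i) → take s xs ≡ take s ys
  take-≡-pointwise d zero xs ys _ _ _ = refl
  take-≡-pointwise d (suc s) (x ∷ xs) (y ∷ ys) (s≤s s≤xs) (s≤s s≤ys) eq =
    cong₂ _∷_ (eq 0 (s≤s z≤n)) (take-≡-pointwise d s xs ys s≤xs s≤ys (λ i i<s → eq (suc i) (s≤s i<s)))

  applyUpTo-cong : {f g : ℕ → A} → (∀ i → f i ≡ g i) → ∀ m → applyUpTo f m ≡ applyUpTo g m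
  applyUpTo-cong f≗g zero = refl
  applyUpTo-cong f≗g (suc m) = cong₂ _∷_ (f≗g 0) (applyUpTo-cong (f≗g ∘ suc) m)

  applyUpTo-++ : ∀ (f : ℕ → A) m m' → applyUpTo f (m + m') ≡ applyUpTo f m ++ applyUpTo (λ i → f (m + i)) m'
  applyUpTo-++ f zero m' = refl
  applyUpTo-++ f (suc m) m' = cong (f 0 ∷_) (applyUpTo-++ (f ∘ suc) m m')

  applyUpTo-≡⇒ : {f g : ℕ → A} → ∀ m → applyUpTo f m ≡ applyUpTo g m → ∀ i → i < m → f i ≡ g i
  applyUpTo-≡⇒ (suc m) eq zero _ = ∷-injectiveˡ eq
  applyUpTo-≡⇒ (suc m) eq (suc i) (s≤s i<m) = applyUpTo-≡⇒ m (∷-injectiveʳ eq) i i<m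

  applyUpTo-nth : ∀ d xs → applyUpTo (nth d xs) (length xs) ≡ xs
  applyUpTo-nth d [] = refl
  applyUpTo-nth d (x ∷ xs) = cong (x ∷_) (applyUpTo-nth d xs)

  ++-split : ∀ {ws xs ys zs : List A} → length ws ≡ length ys → ws ++ xs ≡ ys ++ zs → ws ≡ ys × xs ≡ zs
  ++-split {[]} {ys = []} _ eq = refl , eq
  ++-split {w ∷ ws} {ys = y ∷ ys} |ws|≡|ys| eq with ∷-injective eq
  ... | refl , eq' = map₁ (cong (w ∷_)) (++-split (suc-injective |ws|≡|ys|) eq')

  reverse-++-∷ : ∀ h (x : A) k → reverse (h ++ x ∷ k) ≡ reverse k ++ x ∷ reverse h
  reverse-++-∷ h x k = begin
    reverse (h ++ x ∷ k)               ≡⟨ reverse-++ h (x ∷ k) ⟩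
    reverse (x ∷ k) ++ reverse h       ≡⟨ cong (_++ reverse h) (unfold-reverse x k) ⟩
    (reverse k ++ [ x ]) ++ reverse h  ≡⟨ ++-assoc (reverse k) [ x ] (reverse h) ⟩
    reverse k ++ x ∷ reverse h         ∎
    where open ≡-Reasoning

module _ {A : Set} {R : A → A → Set} where

  IsPath-tail : ∀ {x xs} → IsPath R (x ∷ xs) → IsPath R xs
  IsPath-tail (unique , linked) = AllPairs.tail unique , Linked.tail linked

  IsPath-++⁻ : ∀ xs {ys} → IsPath R (xs ++ ys) → IsPath R xs × IsPath R ys
  IsPath-++⁻ [] path = ([] , []) , path
  IsPath-++⁻ (x ∷ xs) path@(x∉ ∷ _ , linked) with IsPath-++⁻ xs (IsPath-tail path)
  ... | (unique , linked') , suffix = (AllProps.++⁻ˡ xs x∉ ∷ unique , prepend xs linked linked') , suffix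
    where
    prepend : ∀ xs {ys} → Linked R (x ∷ xs ++ ys) → Linked R xs → Linked R (x ∷ xs)
    prepend [] _ _ = [-]
    prepend (_ ∷ _) (x∼y ∷ _) linked' = x∼y ∷ linked'

  IsPath-reverse : (∀ {x y} → R x y → R y x) → ∀ {xs} → IsPath R xs → IsPath R (reverse xs)
  IsPath-reverse sym-R {xs} (unique , linked) =
    PermProps.Unique-resp-↭ (setoid A) (Perm.↭-sym (setoid A) (PermProps.↭-reverse (setoid A) xs)) unique ,
    linked-reverse linked
    where
    linked-reverseAcc : ∀ {x xs acc} → Linked R (x ∷ xs) → Linked R (x ∷ acc) → Linked R (reverseAcc acc (x ∷ xs))
    linked-reverseAcc {xs = []} _ acc-linked = acc-linked
    linked-reverseAcc {xs = _ ∷ _} (x∼y ∷ linked) acc-linked = linked-reverseAcc linked (sym-R x∼y ∷ acc-linked)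
    linked-reverse : ∀ {xs} → Linked R xs → Linked R (reverse xs)
    linked-reverse [] = []
    linked-reverse {_ ∷ _} linked = linked-reverseAcc linked [-]

length-cartesianProductWith : {A B C : Set} (f : A → B → C) (xs : List A) (ys : List B) →
                              length (cartesianProductWith f xs ys) ≡ length xs * length ys
length-cartesianProductWith f [] ys = refl
length-cartesianProductWith f (x ∷ xs) ys =
  trans (length-++ (map (f x) ys)) (cong₂ _+_ (length-map (f x) ys) (length-cartesianProductWith f xs ys))

Square : {X : Set} → (ℕ → X) → ℕ → ℕ → Set
Square f j s = ∀ i → i < s → f (j + i) ≡ f (j + (s + i))

square-through-unique : {X : Set} {f : ℕ → X} {j s d : ℕ} → d < s + s →
                        (∀ p → f p ≡ f (j + d) → p ≡ j + d) → Square f j s → s ≡ 0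
square-through-unique {j = j} {s} {d} d<2s unique sq with d <? s
... | yes d<s = +-cancelʳ-≡ d s 0 (+-cancelˡ-≡ j (s + d) d (unique (j + (s + d)) (sym (sq d d<s))))
... | no d≮s with m≤n⇒∃[o]m+o≡n (≮⇒≥ d≮s)
...   | e , refl = sym (+-cancelʳ-≡ e 0 s (+-cancelˡ-≡ j e (s + e) (unique (j + e) (sq e (+-cancelˡ-< s e s d<2s)))))

module SquareFreeWords (r : ℕ) where

  Word : Set
  Word = List (Fin r)

  SquarePrefix : Word → ℕ → Set
  SquarePrefix v s = 1 ≤ s × s + s ≤ length v × take s v ≡ take s (drop s v)

  HasSquarePrefix : Word → Set
  HasSquarePrefix v = ∃ (SquarePrefix v)

  hasSquarePrefix? : ∀ v → Dec (HasSquarePrefix v)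
  hasSquarePrefix? v =
    map′ (λ (s , _ , sq) → s , sq) (λ (s , sq) → s , bounded sq , sq) (anyUpTo? squarePrefix? (suc (length v)))
    where
    squarePrefix? : ∀ s → Dec (SquarePrefix v s)
    squarePrefix? s = (1 ≤? s) ×-dec (s + s ≤? length v) ×-dec ≡-dec Fin._≟_ (take s v) (take s (drop s v))
    bounded : ∀ {s} → SquarePrefix v s → s < suc (length v)
    bounded {s} (_ , 2s≤v , _) = s≤s (≤-trans (m≤m+n s s) 2s≤v)

  SquareFree : Word → Set
  SquareFree [] = ⊤
  SquareFree (a ∷ w) = ¬ HasSquarePrefix (a ∷ w) × SquareFree w

  SquareFree-drop : ∀ m {v} → SquareFree v → SquareFree (drop m v)
  SquareFree-drop zero sf = sf
  SquareFree-drop (suc m) {[]} sf = tt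
  SquareFree-drop (suc m) {a ∷ v} (_ , sf) = SquareFree-drop m sf

  SquareFree⇒¬HasSquarePrefix : ∀ {v} → SquareFree v → ¬ HasSquarePrefix v
  SquareFree⇒¬HasSquarePrefix {[]} _ (suc s , _ , () , _)
  SquareFree⇒¬HasSquarePrefix {_ ∷ _} (¬sq , _) = ¬sq

  SquareFree⇒¬Square : ∀ d {v} → SquareFree v → ∀ {j s} → 1 ≤ s → j + (s + s) ≤ length v → ¬ Square (nth d v) j s
  SquareFree⇒¬Square d {v} sf {j} {s} 1≤s fits sq =
    SquareFree⇒¬HasSquarePrefix (SquareFree-drop j sf) (s , 1≤s , 2s≤u , halves)
    where
    u : Word
    u = drop j v
    2s≤u : s + s ≤ length u
    2s≤u = subst (s + s ≤_) (sym (length-drop j v)) (subst (_≤ length v ∸ j) (m+n∸m≡n j (s + s)) (∸-monoˡ-≤ j fits))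
    halves : take s u ≡ take s (drop s u)
    halves = take-≡-pointwise d s u (drop s u) (≤-trans (m≤m+n s s) 2s≤u)
               (subst (s ≤_) (sym (length-drop s u)) (subst (_≤ length u ∸ s) (m+n∸m≡n s s) (∸-monoˡ-≤ s 2s≤u)))
               λ i i<s → begin
                 nth d u i               ≡⟨ nth-drop d j v i ⟩
                 nth d v (j + i)         ≡⟨ sq i i<s ⟩
                 nth d v (j + (s + i))   ≡⟨ nth-drop d j v (s + i) ⟨
                 nth d u (s + i)         ≡⟨ nth-drop d s u i ⟨
                 nth d (drop s u) i      ∎
      where open ≡-Reasoning

  extensions : List Word → List Word
  extensions = cartesianProductWith _∷_ (allFin r)

  squareFreeWords : ℕ → List Word
  squareFreeWords zero = [ [] ]
  squareFreeWords (suc n) = filter (¬? ∘ hasSquarePrefix?) (extensions (squareFreeWords n))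

  squareFreeCount : ℕ → ℕ
  squareFreeCount n = length (squareFreeWords n)

  ∈-squareFreeWords⁻ : ∀ n {v} → v ∈ squareFreeWords n → length v ≡ n × SquareFree v
  ∈-squareFreeWords⁻ zero (here refl) = refl , tt
  ∈-squareFreeWords⁻ (suc n) v∈ with ∈-filter⁻ (¬? ∘ hasSquarePrefix?) {xs = extensions (squareFreeWords n)} v∈
  ... | v∈ext , ¬sq with ∈-cartesianProductWith⁻ _∷_ (allFin r) (squareFreeWords n) v∈ext
  ... | a , w , _ , w∈ , refl with ∈-squareFreeWords⁻ n w∈
  ... | refl , sf = refl , ¬sq , sf

  ∈-squareFreeWords⁺ : ∀ {v} → SquareFree v → v ∈ squareFreeWords (length v)
  ∈-squareFreeWords⁺ {[]} _ = here refl
  ∈-squareFreeWords⁺ {a ∷ w} (¬sq , sf) =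
    ∈-filter⁺ (¬? ∘ hasSquarePrefix?) (∈-cartesianProductWith⁺ _∷_ (∈-allFin a) (∈-squareFreeWords⁺ sf)) ¬sq

  extensions-unique : ∀ {ws} → Unique ws → Unique (extensions ws)
  extensions-unique = Unique.cartesianProductWith⁺ _∷_ ∷-injective (Unique.allFin⁺ r)

  squareFreeWords-unique : ∀ n → Unique (squareFreeWords n)
  squareFreeWords-unique zero = [] ∷ []
  squareFreeWords-unique (suc n) = Unique.filter⁺ _ (extensions-unique (squareFreeWords-unique n))

  doubledWords : ℕ → ℕ → List Word
  doubledWords n zero = []
  doubledWords n (suc l) = map (λ u → take (n ∸ l) u ++ u) (squareFreeWords (suc l)) ++ doubledWords n l

  countUpTo : ℕ → ℕ
  countUpTo zero = 0
  countUpTo (suc l) = squareFreeCount (suc l) + countUpTo l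

  length-doubledWords : ∀ n m → length (doubledWords n m) ≡ countUpTo m
  length-doubledWords n zero = refl
  length-doubledWords n (suc l) =
    trans (length-++ (map _ (squareFreeWords (suc l))))
          (cong₂ _+_ (length-map _ (squareFreeWords (suc l))) (length-doubledWords n l))

  ∈-doubledWords : ∀ n {m l u} → l < m → u ∈ squareFreeWords (suc l) → take (n ∸ l) u ++ u ∈ doubledWords n m
  ∈-doubledWords n {suc m} l<m u∈ with m≤n⇒m<n∨m≡n (≤-pred l<m)
  ... | inj₁ l<m' = ∈-++⁺ʳ (map _ (squareFreeWords (suc m))) (∈-doubledWords n l<m' u∈)
  ... | inj₂ refl = ∈-++⁺ˡ (∈-map⁺ (λ u → take (n ∸ m) u ++ u) u∈)

  -- If a w starts with a square x x and w is square-free, then a w = x u where the suffix u is square-free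
  -- and x is the prefix of u of length |x|.
  squarePrefixed∈doubledWords : ∀ n {a w} → w ∈ squareFreeWords n → HasSquarePrefix (a ∷ w) →
                                a ∷ w ∈ doubledWords n n
  squarePrefixed∈doubledWords n {a} {w} w∈ (suc s , _ , 2s≤ , halves) with ∈-squareFreeWords⁻ n w∈
  ... | |w|≡n , sf
    with m≤n⇒∃[o]m+o≡n (≤-trans (m≤n+m (suc s) s) (≤-pred (subst (suc s + suc s ≤_) (cong suc |w|≡n) 2s≤)))
  ... | l , refl = subst (_∈ doubledWords n n) reassemble (∈-doubledWords n (m<n+m l {suc s} z<s) u∈)
    where
    u : Word
    u = drop s w
    |u|≡1+l : length u ≡ suc l
    |u|≡1+l = begin
      length (drop s w)   ≡⟨ length-drop s w ⟩
      length w ∸ s        ≡⟨ cong (_∸ s) |w|≡n ⟩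
      suc s + l ∸ s       ≡⟨ cong (_∸ s) (+-suc s l) ⟨
      s + suc l ∸ s       ≡⟨ m+n∸m≡n s (suc l) ⟩
      suc l               ∎
      where open ≡-Reasoning
    u∈ : u ∈ squareFreeWords (suc l)
    u∈ = subst (λ m → u ∈ squareFreeWords m) |u|≡1+l (∈-squareFreeWords⁺ (SquareFree-drop s sf))
    reassemble : take (n ∸ l) u ++ u ≡ a ∷ w
    reassemble = begin
      take (n ∸ l) u ++ u           ≡⟨ cong (λ m → take m u ++ u) (m+n∸n≡m (suc s) l) ⟩
      take (suc s) u ++ u           ≡⟨ cong (_++ u) halves ⟨
      take (suc s) (a ∷ w) ++ u     ≡⟨ take++drop≡id (suc s) (a ∷ w) ⟩
      a ∷ w                         ∎
      where open ≡-Reasoning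

  extension-count : ∀ n → r * squareFreeCount n ≤ countUpTo n + squareFreeCount (suc n)
  extension-count n = begin
    r * squareFreeCount n                     ≡⟨ length-extensions ⟨
    length ext                                ≡⟨ length-filter-split hasSquarePrefix? ext ⟨
    length squarePrefixed + squareFreeCount (suc n)     ≤⟨ +-monoˡ-≤ (squareFreeCount (suc n)) fewer ⟩
    length (doubledWords n n) + squareFreeCount (suc n) ≡⟨ cong (_+ squareFreeCount (suc n)) (length-doubledWords n n) ⟩
    countUpTo n + squareFreeCount (suc n)     ∎
    where
    open ≤-Reasoning
    ext : List Word
    ext = extensions (squareFreeWords n)
    length-extensions : length ext ≡ r * squareFreeCount n
    length-extensions = trans (length-cartesianProductWith _∷_ (allFin r) (squareFreeWords n))
                              (cong (_* squareFreeCount n) (length-tabulate {n = r} (λ a → a)))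
    squarePrefixed : List Word
    squarePrefixed = filter hasSquarePrefix? ext
    squarePrefixed⊆ : ∀ {v} → v ∈ squarePrefixed → v ∈ doubledWords n n
    squarePrefixed⊆ v∈ with ∈-filter⁻ hasSquarePrefix? {xs = ext} v∈
    ... | v∈ext , sq with ∈-cartesianProductWith⁻ _∷_ (allFin r) (squareFreeWords n) v∈ext
    ... | a , w , _ , w∈ , refl = squarePrefixed∈doubledWords n w∈ sq
    fewer : length squarePrefixed ≤ length (doubledWords n n)
    fewer = length-≤-⊆ (Unique.filter⁺ hasSquarePrefix? (extensions-unique (squareFreeWords-unique n)))
                       squarePrefixed⊆

  -- With C = squareFreeCount, induction on r·C n ≤ Σ_{1≤m≤n} C m + C (n+1) gives Σ_{1≤m≤n} C m ≤ 2·C n,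
  -- hence (r-2)·C n ≤ C (n+1).
  squareFreeCount-≥ : 4 ≤ r → ∀ n → (r ∸ 2) ^ n ≤ squareFreeCount n
  squareFreeCount-≥ 4≤r = power
    where
    b : ℕ
    b = r ∸ 2
    2+b≡r : 2 + b ≡ r
    2+b≡r = m+[n∸m]≡n (≤-trans (s≤s (s≤s z≤n)) 4≤r)
    x+x≤b*x : ∀ x → x + x ≤ b * x
    x+x≤b*x x = subst (_≤ b * x) (cong (x +_) (+-identityʳ x)) (*-monoˡ-≤ x (∸-monoˡ-≤ 2 4≤r))
    step : ∀ {x y z} → r * x ≤ z + y → z ≤ x + x → b * x ≤ y × z ≤ y
    step {x} {y} {z} rx≤z+y z≤2x = b*x≤y , ≤-trans z≤2x (≤-trans (x+x≤b*x x) b*x≤y)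
      where
      b*x≤y : b * x ≤ y
      b*x≤y = +-cancelˡ-≤ (x + x) (b * x) y (begin
        (x + x) + b * x    ≡⟨ +-assoc x x (b * x) ⟩
        (2 + b) * x        ≡⟨ cong (_* x) 2+b≡r ⟩
        r * x              ≤⟨ rx≤z+y ⟩
        z + y              ≤⟨ +-monoˡ-≤ y z≤2x ⟩
        (x + x) + y        ∎)
        where open ≤-Reasoning
    growth : ∀ n → b * squareFreeCount n ≤ squareFreeCount (suc n) × countUpTo n ≤ squareFreeCount (suc n)
    growth zero = step (extension-count 0) z≤n
    growth (suc n) = step (extension-count (suc n)) (+-monoʳ-≤ (squareFreeCount (suc n)) (proj₂ (growth n)))
    power : ∀ n → b ^ n ≤ squareFreeCount n
    power zero = ≤-refl
    power (suc n) = ≤-trans (*-monoʳ-≤ b (power n)) (proj₁ (growth n))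

  squareFreeCode : ∀ {k t} → k ≤ squareFreeCount t →
                   Σ (Fin k → Word) λ code →
                     Injective _≡_ _≡_ code × (∀ i → length (code i) ≡ t × SquareFree (code i))
  squareFreeCode {k} {t} k≤ =
    code ,
    (λ eq → inject≤-injective k≤ k≤ _ _ (lookup-injective (squareFreeWords-unique t) eq)) ,
    (λ i → ∈-squareFreeWords⁻ t (∈-lookup (inject≤ i k≤)))
    where
    code : Fin k → Word
    code i = lookup (squareFreeWords t) (inject≤ i k≤)

data EdgeColour (r : ℕ) : Set where
  letter : Fin r → EdgeColour r
  centre : EdgeColour r

data Colour (r : ℕ) : Set where
  branch : Colour r
  edge : EdgeColour r → Colour r

module _ {r : ℕ} where

  letter-injective : Injective _≡_ _≡_ (letter {r})
  letter-injective refl = refl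

  edge-injective : Injective _≡_ _≡_ (edge {r})
  edge-injective refl = refl

  private
    toSum : Colour r → Fin r ⊎ Fin 2
    toSum (edge (letter a)) = inj₁ a
    toSum (edge centre) = inj₂ Fin.zero
    toSum branch = inj₂ (Fin.suc Fin.zero)

    fromSum : Fin r ⊎ Fin 2 → Colour r
    fromSum (inj₁ a) = edge (letter a)
    fromSum (inj₂ Fin.zero) = edge centre
    fromSum (inj₂ (Fin.suc _)) = branch

    fromSum-toSum : ∀ c → fromSum (toSum c) ≡ c
    fromSum-toSum (edge (letter a)) = refl
    fromSum-toSum (edge centre) = refl
    fromSum-toSum branch = refl

  encode : Colour r → Fin (r + 2)
  encode c = Fin.join r 2 (toSum c)

  encode-injective : Injective _≡_ _≡_ encode
  encode-injective {c} {c'} eq = begin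
    c                                   ≡⟨ decode-encode c ⟨
    fromSum (Fin.splitAt r (encode c))  ≡⟨ cong (fromSum ∘ Fin.splitAt r) eq ⟩
    fromSum (Fin.splitAt r (encode c')) ≡⟨ decode-encode c' ⟩
    c'                                  ∎
    where
    open ≡-Reasoning
    decode-encode : ∀ c → fromSum (Fin.splitAt r (encode c)) ≡ c
    decode-encode c = trans (cong fromSum (splitAt-join r 2 (toSum c))) (fromSum-toSum c)

-- The default letter a₀ is never read for words of length t.
module EdgeColouring {r : ℕ} (a₀ : Fin r) (t : ℕ) where

  open SquareFreeWords r

  colourAt : Word → Word → ℕ → EdgeColour r
  colourAt A B p with <-cmp p t
  ... | tri< _ _ _ = letter (nth a₀ A p)
  ... | tri≈ _ _ _ = centre
  ... | tri> _ _ _ = letter (nth a₀ B (2 * t ∸ p))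

  colourAt-< : ∀ A B {p} → p < t → colourAt A B p ≡ letter (nth a₀ A p)
  colourAt-< A B {p} p<t with <-cmp p t
  ... | tri< _ _ _ = refl
  ... | tri≈ p≮t _ _ = ⊥-elim (p≮t p<t)
  ... | tri> p≮t _ _ = ⊥-elim (p≮t p<t)

  colourAt-> : ∀ A B {p} → t < p → colourAt A B p ≡ letter (nth a₀ B (2 * t ∸ p))
  colourAt-> A B {p} t<p with <-cmp p t
  ... | tri< _ _ t≮p = ⊥-elim (t≮p t<p)
  ... | tri≈ _ _ t≮p = ⊥-elim (t≮p t<p)
  ... | tri> _ _ _ = refl

  colourAt-t : ∀ A B → colourAt A B t ≡ centre
  colourAt-t A B with <-cmp t t
  ... | tri< t<t _ _ = ⊥-elim (<-irrefl refl t<t)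
  ... | tri≈ _ _ _ = refl
  ... | tri> _ _ t<t = ⊥-elim (<-irrefl refl t<t)

  colourAt-centre⇒ : ∀ A B {p} → colourAt A B p ≡ centre → p ≡ t
  colourAt-centre⇒ A B {p} with <-cmp p t
  ... | tri< _ _ _ = λ ()
  ... | tri≈ _ p≡t _ = λ _ → p≡t
  ... | tri> _ _ _ = λ ()

  2t≡t+t : 2 * t ≡ t + t
  2t≡t+t = cong (t +_) (+-identityʳ t)

  colourAt-reflect : ∀ A B {p q} → p + q ≡ 2 * t → colourAt A B p ≡ colourAt B A q
  colourAt-reflect A B {p} {q} p+q≡2t with <-cmp p t
  ... | tri< p<t _ _ = sym (trans (colourAt-> B A t<q) (cong (letter ∘ nth a₀ A) 2t∸q≡p))
    where
    t<q : t < q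
    t<q = ≰⇒> λ q≤t → <-irrefl (trans p+q≡2t 2t≡t+t) (+-mono-<-≤ p<t q≤t)
    2t∸q≡p : 2 * t ∸ q ≡ p
    2t∸q≡p = trans (cong (_∸ q) (sym p+q≡2t)) (m+n∸n≡m p q)
  ... | tri≈ _ p≡t _ = sym (trans (cong (colourAt B A) q≡t) (colourAt-t B A))
    where
    q≡t : q ≡ t
    q≡t = +-cancelˡ-≡ t q t (trans (cong (_+ q) (sym p≡t)) (trans p+q≡2t 2t≡t+t))
  ... | tri> _ _ t<p = trans (cong (letter ∘ nth a₀ B) 2t∸p≡q) (sym (colourAt-< B A q<t))
    where
    q<t : q < t
    q<t = ≰⇒> λ t≤q → <-irrefl (sym (trans p+q≡2t 2t≡t+t)) (+-mono-<-≤ t<p t≤q)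
    2t∸p≡q : 2 * t ∸ p ≡ q
    2t∸p≡q = trans (cong (_∸ p) (sym p+q≡2t)) (m+n∸m≡n p q)

  square-reflect : ∀ A B {j s j'} → j + (s + s) + j' ≡ suc (2 * t) → Square (colourAt A B) j s → Square (colourAt B A) j' s
  square-reflect A B {j} {s} {j'} fits sq i i<s with m≤n⇒∃[o]m+o≡n i<s
  ... | o , refl = begin
    colourAt B A (j' + i)         ≡⟨ colourAt-reflect B A (suc-injective (trans (shape₁ j j' i o) fits)) ⟩
    colourAt A B (j + (s + o))    ≡⟨ sq o (s≤s (m≤n+m o i)) ⟨
    colourAt A B (j + o)          ≡⟨ colourAt-reflect A B (suc-injective (trans (shape₂ j j' i o) fits)) ⟩
    colourAt B A (j' + (s + i))   ∎
    where
    open ≡-Reasoning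
    shape₁ : ∀ j j' i o → suc ((j' + i) + (j + (suc (i + o) + o))) ≡ j + (suc (i + o) + suc (i + o)) + j'
    shape₁ = solve-∀
    shape₂ : ∀ j j' i o → suc ((j + o) + (j' + (suc (i + o) + i))) ≡ j + (suc (i + o) + suc (i + o)) + j'
    shape₂ = solve-∀

  noSquare-below : ∀ {A} B → SquareFree A → length A ≡ t →
                   ∀ {j s} → 1 ≤ s → j + (s + s) ≤ t → ¬ Square (colourAt A B) j s
  noSquare-below {A} B sfA |A|≡t {j} {s} 1≤s fits sq =
    SquareFree⇒¬Square a₀ sfA 1≤s (subst (j + (s + s) ≤_) (sym |A|≡t) fits) λ i i<s →
      letter-injective (trans (sym (colourAt-< A B (first-half i<s))) (trans (sq i i<s) (colourAt-< A B (second-half i<s))))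
    where
    second-half : ∀ {i} → i < s → j + (s + i) < t
    second-half i<s = <-≤-trans (+-monoʳ-< j (+-monoʳ-< s i<s)) fits
    first-half : ∀ {i} → i < s → j + i < t
    first-half {i} i<s = ≤-<-trans (+-monoʳ-≤ j (m≤n+m i s)) (second-half i<s)

  -- A square avoiding the centre lies in A or, read backwards, in B; one through the centre repeats it.
  noSquare : ∀ {A B} → SquareFree A → length A ≡ t → SquareFree B → length B ≡ t →
             ∀ {j s} → 1 ≤ s → j + (s + s) ≤ suc (2 * t) → ¬ Square (colourAt A B) j s
  noSquare {A} {B} sfA |A|≡t sfB |B|≡t {j} {s} 1≤s fits sq with j + (s + s) ≤? t | t <? j
  ... | yes below | _ = noSquare-below B sfA |A|≡t 1≤s below sq
  ... | no _ | yes above with m≤n⇒∃[o]m+o≡n fits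
  ...   | j' , j+2s+j'≡ = noSquare-below A sfB |B|≡t 1≤s below' (square-reflect A B j+2s+j'≡ sq)
    where
    below' : j' + (s + s) ≤ t
    below' = subst (_≤ t) (+-comm (s + s) j') (+-cancelˡ-≤ (suc t) (s + s + j') t (begin
      suc t + (s + s + j')    ≡⟨ +-assoc (suc t) (s + s) j' ⟨
      suc t + (s + s) + j'    ≤⟨ +-monoˡ-≤ j' (+-monoˡ-≤ (s + s) above) ⟩
      j + (s + s) + j'        ≡⟨ j+2s+j'≡ ⟩
      suc (2 * t)             ≡⟨ cong suc 2t≡t+t ⟩
      suc t + t               ∎))
      where open ≤-Reasoning
  noSquare {A} {B} _ _ _ _ {j} {s} 1≤s _ sq | no across | no ¬above with m≤n⇒∃[o]m+o≡n (≮⇒≥ ¬above)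
  ...   | d , j+d≡t = <-irrefl (sym s≡0) 1≤s
    where
    s≡0 : s ≡ 0
    s≡0 = square-through-unique (+-cancelˡ-< j d (s + s) (subst (_< j + (s + s)) (sym j+d≡t) (≰⇒> across)))
            (λ p same → trans (colourAt-centre⇒ A B (trans same centre-at-t)) (sym j+d≡t))
            sq
      where
      centre-at-t : colourAt A B (j + d) ≡ centre
      centre-at-t = trans (cong (colourAt A B) j+d≡t) (colourAt-t A B)

module Subdivision {n : ℕ} (E : List (Edge n)) (t : ℕ) where

  V : Set
  V = SubV n E (2 * t + 1)

  _∼_ : V → V → Set
  _∼_ = SubAdj E (2 * t + 1)

  ∼-sym : ∀ {x y} → x ∼ y → y ∼ x
  ∼-sym (inj₁ arc) = inj₂ arc
  ∼-sym (inj₂ arc) = inj₁ arc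

  Internal : V → Set
  Internal (inj₁ _) = ⊥
  Internal (inj₂ _) = ⊤

  data Direction : Set where
    fw bw : Direction

  Arc : Set
  Arc = Fin (length E) × Direction

  source target : Arc → Fin n
  source (e , fw) = proj₁ (lookup E e)
  source (e , bw) = proj₂ (lookup E e)
  target (e , fw) = proj₂ (lookup E e)
  target (e , bw) = proj₁ (lookup E e)

  arc-adjacent : ∀ a → Adj E (source a) (target a)
  arc-adjacent (e , fw) = inj₁ (∈-lookup e)
  arc-adjacent (e , bw) = inj₂ (∈-lookup e)

  data AtPosition : Arc → ℕ → V → Set where
    fwd : ∀ {e j} (i : Fin (2 * t + 1)) → toℕ i ≡ j → AtPosition (e , fw) j (inj₂ (e , i))
    bwd : ∀ {e j} (i : Fin (2 * t + 1)) → toℕ i + j ≡ 2 * t → AtPosition (e , bw) j (inj₂ (e , i))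

  toℕ≤2t : (i : Fin (2 * t + 1)) → toℕ i ≤ 2 * t
  toℕ≤2t i = m<1+n⇒m≤n (subst (toℕ i <_) (+-comm (2 * t) 1) (toℕ<n i))

  last-index : {i : Fin (2 * t + 1)} → suc (toℕ i) ≡ 2 * t + 1 → toℕ i ≡ 2 * t
  last-index i+1≡D = suc-injective (trans i+1≡D (+-comm (2 * t) 1))

  AtPosition-≤ : ∀ {a j x} → AtPosition a j x → j ≤ 2 * t
  AtPosition-≤ (fwd i refl) = toℕ≤2t i
  AtPosition-≤ {j = j} (bwd i i+j≡2t) = subst (j ≤_) i+j≡2t (m≤n+m j (toℕ i))

  AtPosition-unique : ∀ {a j x y} → AtPosition a j x → AtPosition a j y → x ≡ y
  AtPosition-unique (fwd i refl) (fwd i' i'≡j) = cong (λ i → inj₂ (_ , i)) (toℕ-injective (sym i'≡j))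
  AtPosition-unique (bwd i i+j≡2t) (bwd i' i'+j≡2t) =
    cong (λ i → inj₂ (_ , i)) (toℕ-injective (+-cancelʳ-≡ _ (toℕ i) (toℕ i') (trans i+j≡2t (sym i'+j≡2t))))

  AtPosition-reverse : ∀ {e j k x} → AtPosition (e , fw) j x → j + k ≡ 2 * t → AtPosition (e , bw) k x
  AtPosition-reverse (fwd i refl) i+k≡2t = bwd i i+k≡2t

  data Ahead (a : Arc) (j : ℕ) : V → Set where
    next : ∀ {y} → AtPosition a (suc j) y → Ahead a j y
    exit : j ≡ 2 * t → Ahead a j (inj₁ (target a))

  data Behind (a : Arc) (j : ℕ) : V → Set where
    prev : ∀ {j' y} → AtPosition a j' y → suc j' ≡ j → Behind a j y
    entry : j ≡ 0 → Behind a j (inj₁ (source a))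

  Behind-unique : ∀ {a j x y} → Behind a j x → Behind a j y → x ≡ y
  Behind-unique (prev ax refl) (prev ay refl) = AtPosition-unique ax ay
  Behind-unique (entry _) (entry _) = refl
  Behind-unique (prev _ refl) (entry ())
  Behind-unique (entry refl) (prev _ ())

  step : ∀ {a j x y} → AtPosition a j x → x ∼ y → Ahead a j y ⊎ Behind a j y
  step (fwd i refl) (inj₁ (middle _ _ i' i+1≡i')) = inj₁ (next (fwd i' (sym i+1≡i')))
  step (fwd i refl) (inj₁ (last _ _ i+1≡D)) = inj₁ (exit (last-index i+1≡D))
  step (fwd i refl) (inj₂ (first _ _ i≡0)) = inj₂ (entry i≡0)
  step (fwd i refl) (inj₂ (middle _ i' _ i'+1≡i)) = inj₂ (prev (fwd i' refl) i'+1≡i)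
  step {j = zero} (bwd i i+0≡2t) (inj₁ (middle _ _ i' i+1≡i')) =
    ⊥-elim (<-irrefl refl (subst (_≤ 2 * t) i'≡1+2t (toℕ≤2t i')))
    where
    i'≡1+2t : toℕ i' ≡ suc (2 * t)
    i'≡1+2t = trans (sym i+1≡i') (cong suc (trans (sym (+-identityʳ (toℕ i))) i+0≡2t))
  step {j = suc j} (bwd i i+j+1≡2t) (inj₁ (middle _ _ i' i+1≡i')) =
    inj₂ (prev (bwd i' (trans (cong (_+ j) (sym i+1≡i')) (trans (sym (+-suc _ j)) i+j+1≡2t))) refl)
  step (bwd i i+j≡2t) (inj₁ (last _ _ i+1≡D)) =
    inj₂ (entry (+-cancelˡ-≡ (2 * t) _ 0 (trans (cong (_+ _) (sym (last-index i+1≡D)))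
                                                (trans i+j≡2t (sym (+-identityʳ (2 * t)))))))
  step (bwd i i+j≡2t) (inj₂ (first _ _ i≡0)) = inj₁ (exit (trans (cong (_+ _) (sym i≡0)) i+j≡2t))
  step (bwd i i+j≡2t) (inj₂ (middle _ i' _ i'+1≡i)) =
    inj₁ (next (bwd i' (trans (+-suc _ _) (trans (cong (_+ _) i'+1≡i) i+j≡2t))))

  data Trace (a : Arc) : ℕ → List V → Set where
    [] : ∀ {j} → j ≤ suc (2 * t) → Trace a j []
    _∷_ : ∀ {j x l} → AtPosition a j x → Trace a (suc j) l → Trace a j (x ∷ l)
    exit∷ : ∀ {l} → Trace a (suc (2 * t)) (inj₁ (target a) ∷ l)

  -- A path that entered an arc cannot turn back, so it runs along the arc.
  follow : ∀ {a j p x l} → Linked _∼_ (x ∷ l) → Unique (p ∷ x ∷ l) → AtPosition a j x → Behind a j p →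
           Trace a j (x ∷ l)
  follow {l = []} _ _ ax _ = ax ∷ [] (s≤s (AtPosition-≤ ax))
  follow {l = y ∷ l} (x∼y ∷ linked) unique@((_ ∷ p≢y ∷ _) ∷ _) ax behind with step ax x∼y
  ... | inj₁ (next ay) = ax ∷ follow linked (AllPairs.tail unique) ay (prev ax refl)
  ... | inj₁ (exit refl) = ax ∷ exit∷
  ... | inj₂ behind' = ⊥-elim (p≢y (Behind-unique behind behind'))

  internalTrace : ∀ {l} → 2 ≤ length l → IsPath _∼_ l → All Internal l → ∃₂ λ a j → Trace a j l
  internalTrace {_ ∷ []} (s≤s ()) _ _
  internalTrace {inj₂ (e , i) ∷ y ∷ l} _ (unique , x∼y ∷ linked) (_ ∷ y-internal ∷ _) with step (fwd {e} i refl) x∼y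
  ... | inj₁ (next ay) = (e , fw) , toℕ i , fwd i refl ∷ follow linked unique ay (prev (fwd i refl) refl)
  ... | inj₁ (exit _) = ⊥-elim y-internal
  ... | inj₂ (entry _) = ⊥-elim y-internal
  ... | inj₂ (prev {j'} ay j'+1≡i) with m≤n⇒∃[o]m+o≡n (subst (_≤ 2 * t) (sym j'+1≡i) (toℕ≤2t i))
  ...   | k , j'+1+k≡2t = (e , bw) , k , ax ∷ follow linked unique ay' (prev ax refl)
    where
    ax : AtPosition (e , bw) k (inj₂ (e , i))
    ax = AtPosition-reverse (fwd i refl) (trans (cong (_+ k) (sym j'+1≡i)) j'+1+k≡2t)
    ay' : AtPosition (e , bw) (suc k) y
    ay' = AtPosition-reverse ay (trans (+-suc j' k) j'+1+k≡2t)

  departure : ∀ {u x} → inj₁ u ∼ x → ∃ λ a → source a ≡ u × AtPosition a 0 x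
  departure (inj₁ (direct _ D≡0)) = ⊥-elim (1+n≢0 (trans (+-comm 1 (2 * t)) D≡0))
  departure (inj₁ (first e i i≡0)) = (e , fw) , refl , fwd i i≡0
  departure (inj₂ (direct _ D≡0)) = ⊥-elim (1+n≢0 (trans (+-comm 1 (2 * t)) D≡0))
  departure (inj₂ (last e i i+1≡D)) = (e , bw) , refl , bwd i (trans (+-identityʳ (toℕ i)) (last-index i+1≡D))

  traceFrom : ∀ {u x l} → IsPath _∼_ (inj₁ u ∷ x ∷ l) → ∃ λ a → source a ≡ u × Trace a 0 (x ∷ l)
  traceFrom (unique , u∼x ∷ linked) with departure u∼x
  ... | a , refl , ax = a , refl , follow linked unique ax (entry refl)

  Trace-exit : ∀ {a j w} mid {post} → Trace a j (mid ++ inj₁ w ∷ post) → All Internal mid →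
               j + length mid ≡ suc (2 * t) × w ≡ target a
  Trace-exit [] (() ∷ _) _
  Trace-exit [] exit∷ _ = +-identityʳ _ , refl
  Trace-exit (_ ∷ mid) (_ ∷ trace) (_ ∷ mid-internal) with Trace-exit mid trace mid-internal
  ... | j+1+|mid|≡ , w≡ = trans (+-suc _ (length mid)) j+1+|mid|≡ , w≡
  Trace-exit (_ ∷ _) exit∷ (() ∷ _)

  branchToBranch : ∀ {u w} mid {post} → IsPath _∼_ (inj₁ u ∷ mid ++ inj₁ w ∷ post) → All Internal mid →
                   length mid ≡ suc (2 * t) × Adj E u w
  branchToBranch [] path _ with traceFrom path
  ... | _ , _ , trace with Trace-exit [] trace []
  ... | () , _
  branchToBranch (x ∷ mid) path mid-internal with traceFrom path
  ... | a , refl , trace with Trace-exit (x ∷ mid) trace mid-internal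
  ... | |mid|≡ , refl = |mid|≡ , arc-adjacent a

  branches : List V → List (Fin n)
  branches [] = []
  branches (inj₁ u ∷ l) = u ∷ branches l
  branches (inj₂ _ ∷ l) = branches l

  branches-++ : ∀ l l' → branches (l ++ l') ≡ branches l ++ branches l'
  branches-++ [] l' = refl
  branches-++ (inj₁ u ∷ l) l' = cong (u ∷_) (branches-++ l l')
  branches-++ (inj₂ _ ∷ l) l' = branches-++ l l'

  ∈-branches⁻ : ∀ {u} l → u ∈ branches l → inj₁ u ∈ l
  ∈-branches⁻ (inj₁ _ ∷ l) (here refl) = here refl
  ∈-branches⁻ (inj₁ _ ∷ l) (there u∈) = there (∈-branches⁻ l u∈)
  ∈-branches⁻ (inj₂ _ ∷ l) u∈ = there (∈-branches⁻ l u∈)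

  noBranch⇒Internal : ∀ l → length (branches l) ≡ 0 → All Internal l
  noBranch⇒Internal [] _ = []
  noBranch⇒Internal (inj₂ _ ∷ l) none = tt ∷ noBranch⇒Internal l none

  firstBranch : ∀ l {w ws} → branches l ≡ w ∷ ws → ∃₂ λ h k → l ≡ h ++ inj₁ w ∷ k × All Internal h
  firstBranch (inj₁ _ ∷ l) refl = [] , l , refl , []
  firstBranch (inj₂ x ∷ l) bs≡ with firstBranch l bs≡
  ... | h , k , refl , h-internal = inj₂ x ∷ h , k , refl , tt ∷ h-internal

  lastBranch : ∀ l → 1 ≤ length (branches l) → ∃₂ λ h g → ∃ λ u → l ≡ h ++ inj₁ u ∷ g × All Internal g
  lastBranch (inj₂ x ∷ l) some with lastBranch l some
  ... | h , g , u , refl , g-internal = inj₂ x ∷ h , g , u , refl , g-internal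
  lastBranch (inj₁ u ∷ l) _ with branches l in bs≡
  ... | [] = [] , l , u , refl , noBranch⇒Internal l (cong length bs≡)
  ... | _ ∷ _ with lastBranch l (subst (λ bs → 1 ≤ length bs) (sym bs≡) (s≤s z≤n))
  ...   | h , g , v , refl , g-internal = inj₁ u ∷ h , g , v , refl , g-internal

  branches-path : ∀ {l} → IsPath _∼_ l → IsPath (Adj E) (branches l)
  branches-path path = unique (proj₁ path) , linked path
    where
    unique : ∀ {l} → Unique l → Unique (branches l)
    unique {[]} _ = []
    unique {inj₂ _ ∷ l} (_ ∷ l!) = unique l!
    unique {inj₁ u ∷ l} (u∉l ∷ l!) =
      All.tabulate (λ w∈ u≡w → All.lookup u∉l (∈-branches⁻ l w∈) (cong inj₁ u≡w)) ∷ unique l!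
    linked : ∀ {l} → IsPath _∼_ l → Linked (Adj E) (branches l)
    linked {[]} _ = []
    linked {inj₂ _ ∷ l} path = linked (IsPath-tail path)
    linked {inj₁ u ∷ l} path with branches l in bs≡ | linked (IsPath-tail path)
    ... | [] | _ = [-]
    ... | w ∷ ws | rest with firstBranch l bs≡
    ...   | mid , post , refl , mid-internal = proj₂ (branchToBranch mid path mid-internal) ∷ rest

module Colouring {n : ℕ} (E : List (Edge n)) {r : ℕ} (a₀ : Fin r) (t : ℕ) {k : ℕ}
                 (φ : Fin n → Fin k) (φ-nonrepetitive : Nonrepetitive (Adj E) k φ)
                 (code : Fin k → List (Fin r)) (code-injective : Injective _≡_ _≡_ code)
                 (code-valid : ∀ i → length (code i) ≡ t × SquareFreeWords.SquareFree r (code i)) where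

  open SquareFreeWords r
  open EdgeColouring a₀ t
  open Subdivision E t

  codeword : Fin n → Word
  codeword u = code (φ u)

  wordColours : Word → List (Colour r)
  wordColours = map (edge ∘ letter)

  arcColour : Arc → ℕ → EdgeColour r
  arcColour a = colourAt (codeword (source a)) (codeword (target a))

  ψ : V → Colour r
  ψ (inj₁ _) = branch
  ψ (inj₂ (e , i)) = edge (arcColour (e , fw) (toℕ i))

  AtPosition-colour : ∀ {a j x} → AtPosition a j x → ψ x ≡ edge (arcColour a j)
  AtPosition-colour (fwd i refl) = refl
  AtPosition-colour (bwd i i+j≡2t) = cong edge (colourAt-reflect _ _ i+j≡2t)

  Trace-colours : ∀ {a j l} → Trace a j l → All Internal l →
                  map ψ l ≡ applyUpTo (λ i → edge (arcColour a (j + i))) (length l) × j + length l ≤ suc (2 * t)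
  Trace-colours {j = j} ([] j≤) [] = refl , subst (_≤ suc (2 * t)) (sym (+-identityʳ j)) j≤
  Trace-colours {a} {j} (ax ∷ trace) (_ ∷ l-internal) with Trace-colours trace l-internal
  ... | colours , fits =
    cong₂ _∷_ (trans (AtPosition-colour ax) (cong (edge ∘ arcColour a) (sym (+-identityʳ j))))
              (trans colours (applyUpTo-cong (λ i → cong (edge ∘ arcColour a) (sym (+-suc j i))) _)) ,
    subst (_≤ suc (2 * t)) (sym (+-suc j _)) fits
  Trace-colours exit∷ (() ∷ _)

  Trace-prefix : ∀ {a j l} m → Trace a j l → j + m ≤ t → m ≤ length l →
                 take m (map ψ l) ≡ applyUpTo (λ i → edge (letter (nth a₀ (codeword (source a)) (j + i)))) m
  Trace-prefix zero _ _ _ = refl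
  Trace-prefix {a} {j} (suc m) (ax ∷ trace) fits (s≤s m≤l) = cong₂ _∷_ head-colour rest
    where
    A : Word
    A = codeword (source a)
    j<t : j < t
    j<t = ≤-trans (s≤s (m≤m+n j m)) (subst (_≤ t) (+-suc j m) fits)
    head-colour : ψ _ ≡ edge (letter (nth a₀ A (j + 0)))
    head-colour = begin
      _                              ≡⟨ AtPosition-colour ax ⟩
      edge (arcColour a j)           ≡⟨ cong edge (colourAt-< A _ j<t) ⟩
      edge (letter (nth a₀ A j))     ≡⟨ cong (λ p → edge (letter (nth a₀ A p))) (+-identityʳ j) ⟨
      _                              ∎
      where open ≡-Reasoning
    rest : take m (map ψ _) ≡ applyUpTo (λ i → edge (letter (nth a₀ A (j + suc i)))) m
    rest = trans (Trace-prefix m trace (subst (_≤ t) (+-suc j m) fits) m≤l)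
                 (applyUpTo-cong (λ i → cong (λ p → edge (letter (nth a₀ A p))) (sym (+-suc j i))) m)
  Trace-prefix (suc m) exit∷ fits _ = ⊥-elim (<-irrefl refl (≤-trans (≤-trans (m≤m+n _ (suc m)) fits) (m≤m+n t (t + 0))))

  codeword-colours : ∀ u → applyUpTo (λ i → edge (letter (nth a₀ (codeword u) i))) t ≡ wordColours (codeword u)
  codeword-colours u = begin
    applyUpTo (λ i → edge (letter (nth a₀ A i))) t  ≡⟨ map-applyUpTo (nth a₀ A) (edge ∘ letter) t ⟨
    wordColours (applyUpTo (nth a₀ A) t)             ≡⟨ cong (wordColours ∘ applyUpTo _) (proj₁ (code-valid (φ u))) ⟨
    wordColours (applyUpTo (nth a₀ A) (length A))    ≡⟨ cong wordColours (applyUpTo-nth a₀ A) ⟩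
    wordColours A                                    ∎
    where
    open ≡-Reasoning
    A : Word
    A = codeword u

  window : ∀ {u l} → IsPath _∼_ (inj₁ u ∷ l) → t ≤ length l → take t (map ψ l) ≡ wordColours (codeword u)
  window {u} {[]} _ t≤0 = trans (take-[] t) (trans (cong (applyUpTo _) (sym (n≤0⇒n≡0 t≤0))) (codeword-colours u))
  window {u} {_ ∷ _} path t≤l with traceFrom path
  ... | a , refl , trace = trans (Trace-prefix t trace ≤-refl t≤l) (codeword-colours u)

  Spaced : List (Colour r) → Set
  Spaced [] = ⊤
  Spaced (branch ∷ cs) = t ≤ length cs × Spaced cs
  Spaced (edge _ ∷ cs) = Spaced cs

  windows : List (Colour r) → List (List (Colour r))
  windows [] = []
  windows (branch ∷ cs) = take t cs ∷ windows cs
  windows (edge _ ∷ cs) = windows cs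

  length-windows : ∀ l → length (windows (map ψ l)) ≡ length (branches l)
  length-windows [] = refl
  length-windows (inj₁ _ ∷ l) = cong suc (length-windows l)
  length-windows (inj₂ _ ∷ l) = length-windows l

  windows-path : ∀ {l} → IsPath _∼_ l → Spaced (map ψ l) →
                 windows (map ψ l) ≡ map (wordColours ∘ codeword) (branches l)
  windows-path {[]} _ _ = refl
  windows-path {inj₁ _ ∷ l} path (t≤ , spaced) =
    cong₂ _∷_ (window path (subst (t ≤_) (length-map ψ l) t≤)) (windows-path (IsPath-tail path) spaced)
  windows-path {inj₂ _ ∷ _} path spaced = windows-path (IsPath-tail path) spaced

  Internal⇒Spaced : ∀ {g} → All Internal g → Spaced (map ψ g)
  Internal⇒Spaced [] = tt
  Internal⇒Spaced (_∷_ {inj₂ _} _ g-internal) = Internal⇒Spaced g-internal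

  Spaced-++ : ∀ h {g} → All Internal g → t ≤ length g → Spaced (map ψ (h ++ g))
  Spaced-++ [] g-internal _ = Internal⇒Spaced g-internal
  Spaced-++ (inj₁ _ ∷ h) {g} g-internal t≤g =
    ≤-trans t≤g (subst (length g ≤_) (sym (trans (length-map ψ (h ++ g)) (length-++ h))) (m≤n+m _ _)) ,
    Spaced-++ h g-internal t≤g
  Spaced-++ (inj₂ _ ∷ h) g-internal t≤g = Spaced-++ h g-internal t≤g

  -- When every branch vertex is followed by a window of t vertices, the colours determine the codewords
  -- of the branch vertices, so a repetition would be a repetition in G.
  spacedRepetition : ∀ xs ys {h g u} → IsPath _∼_ (xs ++ ys) → map ψ xs ≡ map ψ ys →
                     xs ≡ h ++ inj₁ u ∷ g → All Internal g → t ≤ length g → ⊥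
  spacedRepetition xs ys {h} {g} {u} path colours refl g-internal t≤g =
    φ-nonrepetitive (branches xs) (branches ys) some-branch
      (subst (IsPath (Adj E)) (branches-++ xs ys) (branches-path path)) same-codes
    where
    halves : IsPath _∼_ xs × IsPath _∼_ ys
    halves = IsPath-++⁻ xs path
    spaced-xs : Spaced (map ψ xs)
    spaced-xs = subst (Spaced ∘ map ψ) (++-assoc h [ inj₁ u ] g) (Spaced-++ (h ++ [ inj₁ u ]) g-internal t≤g)
    some-branch : 1 ≤ length (branches xs)
    some-branch = subst (λ bs → 1 ≤ length bs) (sym (branches-++ h (inj₁ u ∷ g)))
                        (subst (1 ≤_) (sym (length-++-sucʳ (branches h) u (branches g))) (s≤s z≤n))
    codeColours-injective : Injective _≡_ _≡_ (wordColours ∘ code)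
    codeColours-injective = code-injective ∘ map-injective (letter-injective ∘ edge-injective)
    same-codes : map φ (branches xs) ≡ map φ (branches ys)
    same-codes = map-injective codeColours-injective (begin
      map (wordColours ∘ code) (map φ (branches xs))   ≡⟨ map-∘ (branches xs) ⟨
      map (wordColours ∘ codeword) (branches xs)       ≡⟨ windows-path (proj₁ halves) spaced-xs ⟨
      windows (map ψ xs)                               ≡⟨ cong windows colours ⟩
      windows (map ψ ys)                               ≡⟨ windows-path (proj₂ halves) (subst Spaced colours spaced-xs) ⟩
      map (wordColours ∘ codeword) (branches ys)       ≡⟨ map-∘ (branches ys) ⟩
      map (wordColours ∘ code) (map φ (branches ys))   ∎)
      where open ≡-Reasoning

  branches-colours : ∀ {xs ys} → map ψ xs ≡ map ψ ys → length (branches xs) ≡ length (branches ys)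
  branches-colours {xs} {ys} colours = trans (sym (length-windows xs)) (trans (cong (length ∘ windows) colours) (length-windows ys))

  -- The 2t+1 subdivision vertices between the last branch vertex of xs and the first one of ys
  -- leave at least t of them after the former or before the latter; in the second case reverse the path.
  branchRepetition : ∀ xs ys → IsPath _∼_ (xs ++ ys) → map ψ xs ≡ map ψ ys → 1 ≤ length (branches xs) → ⊥
  branchRepetition xs ys path colours some with lastBranch xs some | branches ys in ys-branches
  ... | _ | [] with () ← subst (1 ≤_) (trans (branches-colours colours) (cong length ys-branches)) some
  ... | xh , xg , u , refl , xg-internal | w ∷ _ with firstBranch ys ys-branches
  ...   | yh , yk , refl , yh-internal with t ≤? length xg
  ...     | yes t≤xg = spacedRepetition xs ys path colours refl xg-internal t≤xg
  ...     | no t≰xg =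
    spacedRepetition (reverse ys) (reverse xs) reversed-path reversed-colours (reverse-++-∷ yh (inj₁ w) yk)
      (All-resp-↭ (↭-sym (↭-reverse yh)) yh-internal) (subst (t ≤_) (sym (length-reverse yh)) t≤yh)
    where
    gap : length (xg ++ yh) ≡ suc (2 * t)
    gap = proj₁ (branchToBranch (xg ++ yh) (proj₂ (IsPath-++⁻ xh (subst (IsPath _∼_) regroup path)))
                                (AllProps.++⁺ xg-internal yh-internal))
      where
      regroup : (xh ++ inj₁ u ∷ xg) ++ yh ++ inj₁ w ∷ yk ≡ xh ++ inj₁ u ∷ (xg ++ yh) ++ inj₁ w ∷ yk
      regroup = trans (++-assoc xh (inj₁ u ∷ xg) _) (cong (λ l → xh ++ inj₁ u ∷ l) (sym (++-assoc xg yh _)))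
    t≤yh : t ≤ length yh
    t≤yh = ≮⇒≥ λ yh<t → <-irrefl refl (subst (suc (2 * t) ≤_) (sym 2t≡t+t)
             (≤-trans (n≤1+n _) (subst (_< t + t) (trans (sym (length-++ xg)) gap) (+-mono-< (≰⇒> t≰xg) yh<t))))
    reversed-path : IsPath _∼_ (reverse ys ++ reverse xs)
    reversed-path = subst (IsPath _∼_) (reverse-++ xs ys) (IsPath-reverse ∼-sym path)
    reversed-colours : map ψ (reverse ys) ≡ map ψ (reverse xs)
    reversed-colours = trans (reverse-map ψ ys) (trans (cong reverse (sym colours)) (sym (reverse-map ψ xs)))

  -- Without branch vertices the path runs along one arc, so a repetition is a square in its colours.
  internalRepetition : ∀ xs ys → 1 ≤ length xs → IsPath _∼_ (xs ++ ys) → map ψ xs ≡ map ψ ys →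
                       All Internal (xs ++ ys) → ⊥
  internalRepetition xs ys 1≤s path colours internal = alongArc (internalTrace 2≤length path internal)
    where
    s : ℕ
    s = length xs
    |xs++ys| : length (xs ++ ys) ≡ s + s
    |xs++ys| = trans (length-++ xs) (cong (s +_) (trans (sym (length-map ψ ys))
                                                   (trans (cong length (sym colours)) (length-map ψ xs))))
    2≤length : 2 ≤ length (xs ++ ys)
    2≤length = subst (2 ≤_) (sym |xs++ys|) (+-mono-≤ 1≤s 1≤s)
    alongArc : (∃₂ λ a j → Trace a j (xs ++ ys)) → ⊥
    alongArc (a , j , trace) =
      noSquare (proj₂ (code-valid _)) (proj₁ (code-valid _)) (proj₂ (code-valid _)) (proj₁ (code-valid _)) 1≤s
        (subst (λ m → j + m ≤ suc (2 * t)) |xs++ys| (proj₂ along))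
        (λ i i<s → edge-injective (applyUpTo-≡⇒ s (trans (sym (proj₁ halves)) (trans colours (proj₂ halves))) i i<s))
      where
      g : ℕ → Colour r
      g i = edge (arcColour a (j + i))
      along : map ψ (xs ++ ys) ≡ applyUpTo g (length (xs ++ ys)) × j + length (xs ++ ys) ≤ suc (2 * t)
      along = Trace-colours trace internal
      halves : map ψ xs ≡ applyUpTo g s × map ψ ys ≡ applyUpTo (λ i → g (s + i)) s
      halves = ++-split (trans (length-map ψ xs) (sym (length-applyUpTo g s))) (begin
        map ψ xs ++ map ψ ys                            ≡⟨ map-++ ψ xs ys ⟨
        map ψ (xs ++ ys)                                ≡⟨ proj₁ along ⟩
        applyUpTo g (length (xs ++ ys))                 ≡⟨ cong (applyUpTo g) |xs++ys| ⟩
        applyUpTo g (s + s)                             ≡⟨ applyUpTo-++ g s s ⟩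
        applyUpTo g s ++ applyUpTo (λ i → g (s + i)) s  ∎)
        where open ≡-Reasoning

  ψ-nonrepetitive : ∀ xs ys → 1 ≤ length xs → IsPath _∼_ (xs ++ ys) → map ψ xs ≡ map ψ ys → ⊥
  ψ-nonrepetitive xs ys 1≤s path colours with length (branches xs) in xs-branches
  ... | suc _ = branchRepetition xs ys path colours (subst (1 ≤_) (sym xs-branches) (s≤s z≤n))
  ... | zero = internalRepetition xs ys 1≤s path colours
                 (AllProps.++⁺ (noBranch⇒Internal xs xs-branches)
                               (noBranch⇒Internal ys (trans (sym (branches-colours colours)) xs-branches)))

  χ : V → Fin (r + 2)
  χ = encode ∘ ψ

  χ-nonrepetitive : Nonrepetitive _∼_ (r + 2) χ
  χ-nonrepetitive xs ys 1≤s path colours =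
    ψ-nonrepetitive xs ys 1≤s path (map-injective encode-injective (trans (sym (map-∘ xs)) (trans colours (map-∘ ys))))

theorem92 : (n : ℕ) (E : List (Edge n)) → Simple n E →
            (r k t : ℕ) → 4 ≤ r → IsPi (Adj E) k → IsCeilLog (r ∸ 2) k t →
            HasNonrepColouring (SubAdj E (2 * t + 1)) (r + 2)
theorem92 n E _ r@(suc _) k t 4≤r ((φ , φ-nonrepetitive) , _) (k≤b^t , _)
  with SquareFreeWords.squareFreeCode r (≤-trans k≤b^t (SquareFreeWords.squareFreeCount-≥ r 4≤r t))
... | code , code-injective , code-valid = χ , χ-nonrepetitive
  where open Colouring E Fin.zero t φ φ-nonrepetitive code code-injective code-valid
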